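{- Let $\mathcal{L}=(L_1,L_2,P,\&_1,\swarrow^1,\nwarrow_1,\dots,\&_n,\swarrow^n,\nwarrow_n)$ be a multi-adjoint frame. Then the following data define a non-trivial quantaloid $\mathcal{Q}_F^{\mathcal{L}}$: (i) objects: $-1,0,1,\dots,n$; (ii) hom-sets: $\mathcal{Q}_F^{\mathcal{L}}(-1,0)=L_1$, $\mathcal{Q}_F^{\mathcal{L}}(0,i)=L_2$, $\mathcal{Q}_F^{\mathcal{L}}(-1,i)=P$ for $i=1,\dots,n$; $\mathcal{Q}_F^{\mathcal{L}}(i,i)=\{\bot_{i,i}<\mathrm{id}_i\}$ for $i=-1,0,1,\dots,n$; and $\mathcal{Q}_F^{\mathcal{L}}(i,j)=\{\bot_{i,j}\}$ (one element) whenever $-1\le j<i\le n$ or $0<i<j\le n$; (iii) composition: $v\circ u=u\,\&_i\,v$ for $u\in\mathcal{Q}_F^{\mathcal{L}}(-1,0)=L_1$, $v\in\mathcal{Q}_F^{\mathcal{L}}(0,i)=L_2$ ($i=1,\dots,n$); composition with identities is given by the identity law, and all other composites are the bottom element of the relevant hom-set. Moreover, the left and right implications satisfy $w/u=w\nwarrow_i u$ and $v\backslash w=w\swarrow^i v$ for all $u\in\mathcal{Q}_F^{\mathcal{L}}(-1,0)=L_1$, $v\in\mathcal{Q}_F^{\mathcal{L}}(0,i)=L_2$, $w\in\mathcal{Q}_F^{\mathcal{L}}(-1,i)=P$ ($i=1,\dots,n$), all other implications being trivial.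
   Context: A multi-adjoint frame $\mathcal{L}=(L_1,L_2,P,\&_1,\swarrow^1,\nwarrow_1,\dots,\&_n,\swarrow^n,\nwarrow_n)$ consists of complete lattices $L_1,L_2,P$ and, for each $i=1,\dots,n$, maps $\&_i:L_1\times L_2\to P$, $\swarrow^i:P\times L_2\to L_1$, $\nwarrow_i:P\times L_1\to L_2$ such that $x\,\&_i\,y\le z\iff x\le z\swarrow^i y\iff y\le z\nwarrow_i x$ for all $x\in L_1,y\in L_2,z\in P$ (an adjoint triple). A quantaloid is a category whose hom-sets are complete lattices and whose composition preserves arbitrary joins in each variable; for $u\in\mathcal{Q}(p,q)$, $v\in\mathcal{Q}(q,r)$, $w\in\mathcal{Q}(p,r)$ the left and right implications $w/u\in\mathcal{Q}(q,r)$, $v\backslash w\in\mathcal{Q}(p,q)$ are defined by $v\circ u\le w\iff v\le w/u\iff u\le v\backslash w$. It is non-trivial if $\bot_{q,q}<\mathrm{id}_q$ for every object $q$, where $\bot_{p,q}$ is the bottom of $\mathcal{Q}(p,q)$. -}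

module Defs where

open import Level using (0ℓ)
open import Data.Nat using (ℕ)
open import Data.Fin using (Fin) renaming (_≟_ to _≟F_)
open import Data.Bool using (Bool; true; false; _∧_; if_then_else_)
open import Data.Bool.Properties as BoolP using ()
open import Data.Unit using (⊤; tt)
open import Data.Unit.Properties as UnitP using ()
open import Data.Empty using (⊥)
open import Data.Product using (Σ; ∃; _,_; _×_; proj₁)
open import Relation.Binary.Bundles using (Poset)
open import Relation.Binary.PropositionalEquality using (_≡_; refl)
open import Relation.Nullary using (Dec; yes; no; ¬_)
open import Function.Bundles using (_⇔_)
open import Axiom.ExcludedMiddle using (ExcludedMiddle)

record CompleteLattice : Set₁ where
  field
    poset : Poset 0ℓ 0ℓ 0ℓ
  open Poset poset public
  field
    ⋁       : {I : Set} → (I → Carrier) → Carrier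
    ⋁-upper : {I : Set} (f : I → Carrier) (i : I) → f i ≤ ⋁ f
    ⋁-least : {I : Set} (f : I → Carrier) (x : Carrier) →
              (∀ i → f i ≤ x) → ⋁ f ≤ x

  bot : Carrier
  bot = ⋁ {⊥} (λ ())

open CompleteLattice using (Carrier)

module _ (L₁ L₂ P : CompleteLattice) where
  private
    module L₁ = CompleteLattice L₁
    module L₂ = CompleteLattice L₂
    module P  = CompleteLattice P

  record IsAdjointTriple (& : L₁.Carrier → L₂.Carrier → P.Carrier)
                         (↙ : P.Carrier → L₂.Carrier → L₁.Carrier)
                         (↖ : P.Carrier → L₁.Carrier → L₂.Carrier) : Set where
    field
      adj₁ : ∀ x y z → (& x y P.≤ z) ⇔ (x L₁.≤ ↙ z y)
      adj₂ : ∀ x y z → (x L₁.≤ ↙ z y) ⇔ (y L₂.≤ ↖ z x)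

record MultiAdjointFrame (n : ℕ) : Set₁ where
  field
    L₁ L₂ P : CompleteLattice
    &  : Fin n → Carrier L₁ → Carrier L₂ → Carrier P
    ↙  : Fin n → Carrier P → Carrier L₂ → Carrier L₁
    ↖  : Fin n → Carrier P → Carrier L₁ → Carrier L₂
    isAdjointTriple : ∀ i → IsAdjointTriple L₁ L₂ P (& i) (↙ i) (↖ i)

module _ (Obj : Set) (Hom : Obj → Obj → CompleteLattice) where
  private
    H : Obj → Obj → Set
    H a b = Carrier (Hom a b)
    module Hm {a b : Obj} = CompleteLattice (Hom a b)
    open Hm

  module _ (id : (a : Obj) → H a a)
           (comp : (a b c : Obj) → H b c → H a b → H a c) where

    record IsQuantaloid : Set₁ where
      field
        comp-cong : ∀ a b c {v v' : H b c} {u u' : H a b} →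
                    v ≈ v' → u ≈ u' → comp a b c v u ≈ comp a b c v' u'
        assoc     : ∀ a b c d (w : H c d) (v : H b c) (u : H a b) →
                    comp a c d w (comp a b c v u) ≈ comp a b d (comp b c d w v) u
        identityˡ : ∀ a b (u : H a b) → comp a b b (id b) u ≈ u
        identityʳ : ∀ a b (u : H a b) → comp a a b u (id a) ≈ u
        ⋁-distribˡ : ∀ a b c (v : H b c) {I : Set} (f : I → H a b) →
                    comp a b c v (⋁ f) ≈ ⋁ (λ i → comp a b c v (f i))
        ⋁-distribʳ : ∀ a b c {I : Set} (g : I → H b c) (u : H a b) →
                    comp a b c (⋁ g) u ≈ ⋁ (λ i → comp a b c (g i) u)

    NonTrivial : Set
    NonTrivial = ∀ q → (bot {q} {q} ≤ id q) × ¬ (bot {q} {q} ≈ id q)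

    IsLeftImplication : ∀ a b c → H a c → H a b → H b c → Set
    IsLeftImplication a b c w u x = ∀ (v : H b c) → (comp a b c v u ≤ w) ⇔ (v ≤ x)

    IsRightImplication : ∀ a b c → H a c → H b c → H a b → Set
    IsRightImplication a b c w v x = ∀ (u : H a b) → (comp a b c v u ≤ w) ⇔ (u ≤ x)

-- The two-element lattice {⊥ < id} (needs excluded middle for joins)
-- and the one-element lattice {⊥}.

module _ (em : ExcludedMiddle 0ℓ) where

  decBool : {A : Set} → Dec A → Bool
  decBool (yes _) = true
  decBool (no  _) = false

  twoJoin : {I : Set} → (I → Bool) → Bool
  twoJoin {I} f = decBool (em {∃ λ i → f i ≡ true})

  private
    upper-aux : {I : Set} (f : I → Bool) (i : I) (d : Dec (∃ λ i → f i ≡ true)) →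
                f i Data.Bool.≤ decBool d
    upper-aux f i (yes _) with f i
    ... | false = Data.Bool.f≤t
    ... | true  = Data.Bool.b≤b
    upper-aux f i (no ¬e) with f i in eq
    ... | false = Data.Bool.b≤b
    ... | true  with () ← ¬e (i , eq)

    least-aux : {I : Set} (f : I → Bool) (x : Bool) → (∀ i → f i Data.Bool.≤ x) →
                (d : Dec (∃ λ i → f i ≡ true)) → decBool d Data.Bool.≤ x
    least-aux f true  h d = Data.Bool.Properties.≤-maximum _
      where import Data.Bool.Properties
    least-aux f false h (no _) = Data.Bool.b≤b
    least-aux f false h (yes (i , e)) with f i | h i
    least-aux f false h (yes (i , ())) | false | _

  twoJoin-upper : {I : Set} (f : I → Bool) (i : I) → f i Data.Bool.≤ twoJoin f
  twoJoin-upper f i = upper-aux f i em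

  twoJoin-least : {I : Set} (f : I → Bool) (x : Bool) →
                  (∀ i → f i Data.Bool.≤ x) → twoJoin f Data.Bool.≤ x
  twoJoin-least f x h = least-aux f x h em

  𝟚 : CompleteLattice
  𝟚 = record { poset = BoolP.≤-poset ; ⋁ = twoJoin
             ; ⋁-upper = twoJoin-upper ; ⋁-least = twoJoin-least }

𝟙 : CompleteLattice
𝟙 = record { poset = UnitP.≡-poset ; ⋁ = λ _ → tt
           ; ⋁-upper = λ _ _ → refl ; ⋁-least = λ _ _ _ → refl }

data Obj (n : ℕ) : Set where
  -1ₒ : Obj n
  0ₒ  : Obj n
  pos : Fin n → Obj n      -- pos i  is the object  i+1  ∈ {1,…,n}

module QF (em : ExcludedMiddle 0ℓ) {n : ℕ} (L : MultiAdjointFrame n) where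
  open MultiAdjointFrame L

  diag : {i j : Fin n} → Dec (i ≡ j) → CompleteLattice
  diag (yes _) = 𝟚 em
  diag (no  _) = 𝟙

  Hom : Obj n → Obj n → CompleteLattice
  Hom -1ₒ     -1ₒ     = 𝟚 em
  Hom -1ₒ     0ₒ      = L₁
  Hom -1ₒ     (pos i) = P
  Hom 0ₒ      -1ₒ     = 𝟙
  Hom 0ₒ      0ₒ      = 𝟚 em
  Hom 0ₒ      (pos i) = L₂
  Hom (pos i) -1ₒ     = 𝟙
  Hom (pos i) 0ₒ      = 𝟙
  Hom (pos i) (pos j) = diag (i ≟F j)

  private
    H : Obj n → Obj n → Set
    H a b = Carrier (Hom a b)

    ⊥[_,_] : ∀ a b → H a b
    ⊥[ a , b ] = CompleteLattice.bot (Hom a b)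

    idDiag : {i : Fin n} (d : Dec (i ≡ i)) → Carrier (diag d)
    idDiag (yes _) = true
    idDiag (no  _) = tt

  id : (a : Obj n) → H a a
  id -1ₒ     = true
  id 0ₒ      = true
  id (pos i) = idDiag (i ≟F i)

  private
    idOr : (X : CompleteLattice) → Bool → Carrier X → Carrier X
    idOr X true  x = x
    idOr X false _ = CompleteLattice.bot X

    compDiag : {i j k : Fin n} (d₁ : Dec (i ≡ j)) (d₂ : Dec (j ≡ k)) (d₃ : Dec (i ≡ k)) →
               Carrier (diag d₂) → Carrier (diag d₁) → Carrier (diag d₃)
    compDiag (yes _) (yes _) (yes _) v u = u ∧ v
    compDiag (yes _) (no  _) (yes _) v u = false
    compDiag (no  _) _       (yes _) v u = false
    compDiag _       _       (no  _) v u = tt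

    compTo : (X : CompleteLattice) {j k : Fin n} (d : Dec (j ≡ k)) →
             Carrier (diag d) → Carrier X → Carrier X
    compTo X (yes _) v u = idOr X v u
    compTo X (no  _) v u = CompleteLattice.bot X

  comp : (a b c : Obj n) → H b c → H a b → H a c
  comp -1ₒ     -1ₒ     c       v u = idOr (Hom -1ₒ c) u v
  comp -1ₒ     0ₒ      -1ₒ     v u = ⊥[ -1ₒ , -1ₒ ]
  comp -1ₒ     0ₒ      0ₒ      v u = idOr L₁ v u
  comp -1ₒ     0ₒ      (pos i) v u = & i u v
  comp -1ₒ     (pos j) -1ₒ     v u = ⊥[ -1ₒ , -1ₒ ]
  comp -1ₒ     (pos j) 0ₒ      v u = ⊥[ -1ₒ , 0ₒ ]
  comp -1ₒ     (pos j) (pos k) v u = compTo P (j ≟F k) v u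
  comp 0ₒ      -1ₒ     c       v u = ⊥[ 0ₒ , c ]
  comp 0ₒ      0ₒ      c       v u = idOr (Hom 0ₒ c) u v
  comp 0ₒ      (pos j) -1ₒ     v u = ⊥[ 0ₒ , -1ₒ ]
  comp 0ₒ      (pos j) 0ₒ      v u = ⊥[ 0ₒ , 0ₒ ]
  comp 0ₒ      (pos j) (pos k) v u = compTo L₂ (j ≟F k) v u
  comp (pos i) -1ₒ     c       v u = ⊥[ pos i , c ]
  comp (pos i) 0ₒ      c       v u = ⊥[ pos i , c ]
  comp (pos i) (pos j) -1ₒ     v u = ⊥[ pos i , -1ₒ ]
  comp (pos i) (pos j) 0ₒ      v u = ⊥[ pos i , 0ₒ ]
  comp (pos i) (pos j) (pos k) v u = compDiag (i ≟F j) (j ≟F k) (i ≟F k) v u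

module Submission where

open import Defs
open import Level using (0ℓ)
open import Data.Nat using (ℕ)
open import Data.Fin using (Fin) renaming (_≟_ to _≟F_)
open import Data.Bool using (Bool; true; false; _∧_)
open import Data.Empty using (⊥-elim)
open import Data.Product using (_×_; _,_; ∃)
open import Data.Sum using (_⊎_; inj₁; inj₂)
open import Function.Base using (_∘_)
open import Function.Bundles using (_⇔_; module Equivalence)
open import Function.Construct.Composition using (_⇔-∘_)
open import Relation.Nullary using (Dec; yes; no; ¬_)
open import Relation.Binary.PropositionalEquality using (_≡_; refl; subst)
  renaming (sym to ≡-sym; trans to ≡-trans)
open import Axiom.ExcludedMiddle using (ExcludedMiddle)

open CompleteLattice using () renaming (Carrier to ∣_∣)
open Equivalence using (to; from)

-- Apart from L₁, L₂ and P, every hom-set is {⊥} or {⊥ < id}. By the adjunctions each &ᵢ is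
-- monotone and preserves joins in both arguments, which gives the distributive laws on the
-- non-trivial hom-sets and identifies the implications with ↖ᵢ and ↙ᵢ. For associativity, a
-- composable triple of morphisms can never have all three factors in L₁, L₂ or P (the only
-- composable pair is L₂ ∘ L₁), so some factor is an identity or a bottom, and the unit laws
-- together with bottom absorption (a consequence of distributivity over the empty join) finish.

module CompleteLatticeProperties (X : CompleteLattice) where
  open CompleteLattice X

  bot-minimum : ∀ x → bot ≤ x
  bot-minimum x = ⋁-least (λ ()) x (λ ())

  ⋁-bot : {I : Set} (f : I → Carrier) → (∀ i → f i ≈ bot) → ⋁ f ≈ bot
  ⋁-bot f f≈bot = antisym (⋁-least f bot (reflexive ∘ f≈bot)) (bot-minimum _)

  bot≈⋁-const-bot : {I : Set} → bot ≈ ⋁ {I} (λ _ → bot)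
  bot≈⋁-const-bot = Eq.sym (⋁-bot _ (λ _ → Eq.refl))

  map-twoJoin : (em : ExcludedMiddle 0ℓ) (g : Bool → Carrier) → g false ≈ bot →
                {I : Set} (f : I → Bool) → g (twoJoin em f) ≈ ⋁ (g ∘ f)
  map-twoJoin em g g-false {I} f = by-cases em
    where
      g≤g-true : ∀ b → g b ≤ g true
      g≤g-true true  = reflexive Eq.refl
      g≤g-true false = trans (reflexive g-false) (bot-minimum _)

      by-cases : (d : Dec (∃ λ i → f i ≡ true)) → g (decBool em d) ≈ ⋁ (g ∘ f)
      by-cases (yes (i , fi≡true)) =
        antisym (subst (λ b → g b ≤ ⋁ (g ∘ f)) fi≡true (⋁-upper (g ∘ f) i))
                (⋁-least (g ∘ f) _ (g≤g-true ∘ f))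
      by-cases (no ∄i) =
        antisym (trans (reflexive g-false) (bot-minimum _)) (⋁-least (g ∘ f) _ g∘f≤g-false)
        where
          g∘f≤g-false : ∀ i → g (f i) ≤ g false
          g∘f≤g-false i with f i in fi
          ... | false = reflexive Eq.refl
          ... | true  = ⊥-elim (∄i (i , fi))

module 𝟚Properties (em : ExcludedMiddle 0ℓ) where
  bot-𝟚 : CompleteLattice.bot (𝟚 em) ≡ false
  bot-𝟚 = decBool-no em (λ ())
    where
      decBool-no : ∀ {A : Set} (d : Dec A) → ¬ A → decBool em d ≡ false
      decBool-no (yes a) ¬a = ⊥-elim (¬a a)
      decBool-no (no _)  _  = refl

  false≡⋁-const-false : {I : Set} → false ≡ twoJoin em {I} (λ _ → false)
  false≡⋁-const-false =
    ≡-sym (≡-trans (CompleteLatticeProperties.⋁-bot (𝟚 em) _ (λ _ → ≡-sym bot-𝟚)) bot-𝟚)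

  bot<true : CompleteLattice._≤_ (𝟚 em) (CompleteLattice.bot (𝟚 em)) true
             × ¬ (CompleteLattice.bot (𝟚 em) ≡ true)
  bot<true = CompleteLatticeProperties.bot-minimum (𝟚 em) true
           , λ bot≡true → false≢true (≡-trans (≡-sym bot-𝟚) bot≡true)
    where
      false≢true : ¬ (false ≡ true)
      false≢true ()

module AdjointTripleProperties {L₁ L₂ P : CompleteLattice}
  {& : ∣ L₁ ∣ → ∣ L₂ ∣ → ∣ P ∣} {↙ : ∣ P ∣ → ∣ L₂ ∣ → ∣ L₁ ∣} {↖ : ∣ P ∣ → ∣ L₁ ∣ → ∣ L₂ ∣}
  (triple : IsAdjointTriple L₁ L₂ P & ↙ ↖) where
  private
    module L₁ = CompleteLattice L₁
    module L₂ = CompleteLattice L₂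
    module P  = CompleteLattice P
  open IsAdjointTriple triple

  &≤⇔≤↙ : ∀ x y z → (& x y P.≤ z) ⇔ (x L₁.≤ ↙ z y)
  &≤⇔≤↙ = adj₁

  &≤⇔≤↖ : ∀ x y z → (& x y P.≤ z) ⇔ (y L₂.≤ ↖ z x)
  &≤⇔≤↖ x y z = adj₂ x y z ⇔-∘ adj₁ x y z

  &-mono : ∀ {x x' y y'} → x L₁.≤ x' → y L₂.≤ y' → & x y P.≤ & x' y'
  &-mono {x} {x'} {y} {y'} x≤x' y≤y' = P.trans
    (from (&≤⇔≤↙ x y (& x' y)) (L₁.trans x≤x' (to (&≤⇔≤↙ x' y _) P.refl)))
    (from (&≤⇔≤↖ x' y (& x' y')) (L₂.trans y≤y' (to (&≤⇔≤↖ x' y' _) P.refl)))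

  &-cong : ∀ {x x' y y'} → x L₁.≈ x' → y L₂.≈ y' → & x y P.≈ & x' y'
  &-cong x≈x' y≈y' = P.antisym
    (&-mono (L₁.reflexive x≈x') (L₂.reflexive y≈y'))
    (&-mono (L₁.reflexive (L₁.Eq.sym x≈x')) (L₂.reflexive (L₂.Eq.sym y≈y')))

  &-⋁ˡ : ∀ {I : Set} (f : I → L₁.Carrier) y → & (L₁.⋁ f) y P.≈ P.⋁ (λ i → & (f i) y)
  &-⋁ˡ f y = P.antisym
    (from (&≤⇔≤↙ _ y _) (L₁.⋁-least f _ (λ i → to (&≤⇔≤↙ _ y _) (P.⋁-upper _ i))))
    (P.⋁-least _ _ (λ i → &-mono (L₁.⋁-upper f i) L₂.refl))

  &-⋁ʳ : ∀ {I : Set} x (f : I → L₂.Carrier) → & x (L₂.⋁ f) P.≈ P.⋁ (λ i → & x (f i))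
  &-⋁ʳ x f = P.antisym
    (from (&≤⇔≤↖ x _ _) (L₂.⋁-least f _ (λ i → to (&≤⇔≤↖ x _ _) (P.⋁-upper _ i))))
    (P.⋁-least _ _ (λ i → &-mono L₁.refl (L₂.⋁-upper f i)))

module QFProperties (em : ExcludedMiddle 0ℓ) {n : ℕ} (L : MultiAdjointFrame n) where
  open MultiAdjointFrame L
  open QF em L
  open 𝟚Properties em
  open CompleteLatticeProperties using (map-twoJoin; ⋁-bot)
  private
    module L₁ = CompleteLattice L₁
    module L₂ = CompleteLattice L₂
    module P  = CompleteLattice P
    module &ᵢ (i : Fin n) = AdjointTripleProperties (isAdjointTriple i)

    H : Obj n → Obj n → Set
    H a b = ∣ Hom a b ∣

    module HomLattice (a b : Obj n) = CompleteLattice (Hom a b)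

  HomEq : ∀ a b → H a b → H a b → Set
  HomEq a b = HomLattice._≈_ a b
  syntax HomEq a b u u' = u ≈[ a ⇒ b ] u'

  ⊥[_⇒_] : ∀ a b → H a b
  ⊥[ a ⇒ b ] = HomLattice.bot a b

  ⋁[_⇒_] : ∀ a b {I : Set} → (I → H a b) → H a b
  ⋁[ a ⇒ b ] = HomLattice.⋁ a b

  ≈-refl : ∀ a b {u : H a b} → u ≈[ a ⇒ b ] u
  ≈-refl a b = HomLattice.Eq.refl a b

  comp-cong : ∀ a b c {v v' : H b c} {u u' : H a b} →
              v ≈[ b ⇒ c ] v' → u ≈[ a ⇒ b ] u' → comp a b c v u ≈[ a ⇒ c ] comp a b c v' u'
  comp-cong -1ₒ -1ₒ c {u = true}  v≈v' refl = v≈v'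
  comp-cong -1ₒ -1ₒ c {u = false} v≈v' refl = ≈-refl -1ₒ c
  comp-cong -1ₒ 0ₒ -1ₒ _ _ = refl
  comp-cong -1ₒ 0ₒ 0ₒ {v = true}  refl u≈u' = u≈u'
  comp-cong -1ₒ 0ₒ 0ₒ {v = false} refl u≈u' = L₁.Eq.refl
  comp-cong -1ₒ 0ₒ (pos i) v≈v' u≈u' = &ᵢ.&-cong i u≈u' v≈v'
  comp-cong -1ₒ (pos j) -1ₒ _ _ = refl
  comp-cong -1ₒ (pos j) 0ₒ _ _ = L₁.Eq.refl
  comp-cong -1ₒ (pos j) (pos k) v≈v' u≈u' with j ≟F k
  comp-cong -1ₒ (pos j) (pos k) {true}  refl u≈u' | yes _ = u≈u'
  comp-cong -1ₒ (pos j) (pos k) {false} refl u≈u' | yes _ = P.Eq.refl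
  ... | no _ = P.Eq.refl
  comp-cong 0ₒ -1ₒ c _ _ = ≈-refl 0ₒ c
  comp-cong 0ₒ 0ₒ c {u = true}  v≈v' refl = v≈v'
  comp-cong 0ₒ 0ₒ c {u = false} v≈v' refl = ≈-refl 0ₒ c
  comp-cong 0ₒ (pos j) -1ₒ _ _ = refl
  comp-cong 0ₒ (pos j) 0ₒ _ _ = refl
  comp-cong 0ₒ (pos j) (pos k) v≈v' u≈u' with j ≟F k
  comp-cong 0ₒ (pos j) (pos k) {true}  refl u≈u' | yes _ = u≈u'
  comp-cong 0ₒ (pos j) (pos k) {false} refl u≈u' | yes _ = L₂.Eq.refl
  ... | no _ = L₂.Eq.refl
  comp-cong (pos i) -1ₒ c _ _ = ≈-refl (pos i) c
  comp-cong (pos i) 0ₒ c _ _ = ≈-refl (pos i) c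
  comp-cong (pos i) (pos j) -1ₒ _ _ = refl
  comp-cong (pos i) (pos j) 0ₒ _ _ = refl
  comp-cong (pos i) (pos j) (pos k) v≈v' u≈u' with i ≟F j | j ≟F k | i ≟F k
  comp-cong (pos i) (pos j) (pos k) refl refl | yes _ | yes _ | yes _ = refl
  ... | yes _ | no _ | yes _ = refl
  ... | no _  | _    | yes _ = refl
  ... | _     | _    | no _  = refl

  identityˡ : ∀ a b (u : H a b) → comp a b b (id b) u ≈[ a ⇒ b ] u
  identityˡ -1ₒ -1ₒ true  = refl
  identityˡ -1ₒ -1ₒ false = bot-𝟚
  identityˡ -1ₒ 0ₒ _ = L₁.Eq.refl
  identityˡ -1ₒ (pos j) _ with j ≟F j
  ... | yes _  = P.Eq.refl
  ... | no j≢j = ⊥-elim (j≢j refl)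
  identityˡ 0ₒ -1ₒ _ = refl
  identityˡ 0ₒ 0ₒ true  = refl
  identityˡ 0ₒ 0ₒ false = bot-𝟚
  identityˡ 0ₒ (pos j) _ with j ≟F j
  ... | yes _  = L₂.Eq.refl
  ... | no j≢j = ⊥-elim (j≢j refl)
  identityˡ (pos i) -1ₒ _ = refl
  identityˡ (pos i) 0ₒ _ = refl
  identityˡ (pos i) (pos j) u with i ≟F j | j ≟F j
  identityˡ (pos i) (pos j) true  | yes _ | yes _ = refl
  identityˡ (pos i) (pos j) false | yes _ | yes _ = refl
  ... | yes _ | no j≢j = ⊥-elim (j≢j refl)
  ... | no _  | _      = refl

  identityʳ : ∀ a b (u : H a b) → comp a a b u (id a) ≈[ a ⇒ b ] u
  identityʳ -1ₒ b _ = ≈-refl -1ₒ b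
  identityʳ 0ₒ b _ = ≈-refl 0ₒ b
  identityʳ (pos i) -1ₒ _ = refl
  identityʳ (pos i) 0ₒ _ = refl
  identityʳ (pos i) (pos j) _ with i ≟F i | i ≟F j
  ... | yes _  | yes _ = refl
  ... | yes _  | no _  = refl
  ... | no i≢i | _     = ⊥-elim (i≢i refl)

  nonTrivial : NonTrivial (Obj n) Hom id comp
  nonTrivial -1ₒ = bot<true
  nonTrivial 0ₒ = bot<true
  nonTrivial (pos i) with i ≟F i
  ... | yes _  = bot<true
  ... | no i≢i = ⊥-elim (i≢i refl)

  bot≈⋁-const-bot : ∀ a b {I : Set} → ⊥[ a ⇒ b ] ≈[ a ⇒ b ] ⋁[ a ⇒ b ] {I} (λ _ → ⊥[ a ⇒ b ])
  bot≈⋁-const-bot a b = CompleteLatticeProperties.bot≈⋁-const-bot (Hom a b)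

  ⋁-distribˡ : ∀ a b c (v : H b c) {I : Set} (f : I → H a b) →
               comp a b c v (⋁[ a ⇒ b ] f) ≈[ a ⇒ c ] ⋁[ a ⇒ c ] (λ i → comp a b c v (f i))
  ⋁-distribˡ -1ₒ -1ₒ c v f = map-twoJoin (Hom -1ₒ c) em (λ u → comp -1ₒ -1ₒ c v u) (≈-refl -1ₒ c) f
  ⋁-distribˡ -1ₒ 0ₒ -1ₒ _ _ = bot≈⋁-const-bot -1ₒ -1ₒ
  ⋁-distribˡ -1ₒ 0ₒ 0ₒ true  _ = L₁.Eq.refl
  ⋁-distribˡ -1ₒ 0ₒ 0ₒ false _ = bot≈⋁-const-bot -1ₒ 0ₒ
  ⋁-distribˡ -1ₒ 0ₒ (pos i) v f = &ᵢ.&-⋁ˡ i f v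
  ⋁-distribˡ -1ₒ (pos j) -1ₒ _ _ = bot≈⋁-const-bot -1ₒ -1ₒ
  ⋁-distribˡ -1ₒ (pos j) 0ₒ _ _ = bot≈⋁-const-bot -1ₒ 0ₒ
  ⋁-distribˡ -1ₒ (pos j) (pos k) v f with j ≟F k
  ⋁-distribˡ -1ₒ (pos j) (pos k) true  _ | yes _ = P.Eq.refl
  ⋁-distribˡ -1ₒ (pos j) (pos k) false _ | yes _ = bot≈⋁-const-bot -1ₒ (pos k)
  ... | no _ = bot≈⋁-const-bot -1ₒ (pos k)
  ⋁-distribˡ 0ₒ -1ₒ c _ _ = bot≈⋁-const-bot 0ₒ c
  ⋁-distribˡ 0ₒ 0ₒ c v f = map-twoJoin (Hom 0ₒ c) em (λ u → comp 0ₒ 0ₒ c v u) (≈-refl 0ₒ c) f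
  ⋁-distribˡ 0ₒ (pos j) -1ₒ _ _ = refl
  ⋁-distribˡ 0ₒ (pos j) 0ₒ _ _ = bot≈⋁-const-bot 0ₒ 0ₒ
  ⋁-distribˡ 0ₒ (pos j) (pos k) v f with j ≟F k
  ⋁-distribˡ 0ₒ (pos j) (pos k) true  _ | yes _ = L₂.Eq.refl
  ⋁-distribˡ 0ₒ (pos j) (pos k) false _ | yes _ = bot≈⋁-const-bot 0ₒ (pos k)
  ... | no _ = bot≈⋁-const-bot 0ₒ (pos k)
  ⋁-distribˡ (pos i) -1ₒ c _ _ = bot≈⋁-const-bot (pos i) c
  ⋁-distribˡ (pos i) 0ₒ c _ _ = bot≈⋁-const-bot (pos i) c
  ⋁-distribˡ (pos i) (pos j) -1ₒ _ _ = refl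
  ⋁-distribˡ (pos i) (pos j) 0ₒ _ _ = refl
  ⋁-distribˡ (pos i) (pos j) (pos k) v f with i ≟F j | j ≟F k | i ≟F k
  ... | yes _ | yes _ | yes _ = map-twoJoin (𝟚 em) em (_∧ v) (≡-sym bot-𝟚) f
  ... | yes _ | no _  | yes _ = false≡⋁-const-false
  ... | no _  | _     | yes _ = false≡⋁-const-false
  ... | _     | _     | no _  = refl

  ⋁-distribʳ : ∀ a b c {I : Set} (g : I → H b c) (u : H a b) →
               comp a b c (⋁[ b ⇒ c ] g) u ≈[ a ⇒ c ] ⋁[ a ⇒ c ] (λ i → comp a b c (g i) u)
  ⋁-distribʳ -1ₒ -1ₒ c _ true  = ≈-refl -1ₒ c
  ⋁-distribʳ -1ₒ -1ₒ c _ false = bot≈⋁-const-bot -1ₒ c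
  ⋁-distribʳ -1ₒ 0ₒ -1ₒ _ _ = bot≈⋁-const-bot -1ₒ -1ₒ
  ⋁-distribʳ -1ₒ 0ₒ 0ₒ g u = map-twoJoin L₁ em (λ v → comp -1ₒ 0ₒ 0ₒ v u) L₁.Eq.refl g
  ⋁-distribʳ -1ₒ 0ₒ (pos i) g u = &ᵢ.&-⋁ʳ i u g
  ⋁-distribʳ -1ₒ (pos j) -1ₒ _ _ = bot≈⋁-const-bot -1ₒ -1ₒ
  ⋁-distribʳ -1ₒ (pos j) 0ₒ _ _ = bot≈⋁-const-bot -1ₒ 0ₒ
  ⋁-distribʳ -1ₒ (pos j) (pos k) g u with j ≟F k
  ... | yes _ = map-twoJoin P em (λ v → comp -1ₒ -1ₒ (pos j) u v) P.Eq.refl g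
  ... | no _  = bot≈⋁-const-bot -1ₒ (pos k)
  ⋁-distribʳ 0ₒ -1ₒ c _ _ = bot≈⋁-const-bot 0ₒ c
  ⋁-distribʳ 0ₒ 0ₒ c _ true  = ≈-refl 0ₒ c
  ⋁-distribʳ 0ₒ 0ₒ c _ false = bot≈⋁-const-bot 0ₒ c
  ⋁-distribʳ 0ₒ (pos j) -1ₒ _ _ = refl
  ⋁-distribʳ 0ₒ (pos j) 0ₒ _ _ = bot≈⋁-const-bot 0ₒ 0ₒ
  ⋁-distribʳ 0ₒ (pos j) (pos k) g u with j ≟F k
  ... | yes _ = map-twoJoin L₂ em (λ v → comp 0ₒ 0ₒ (pos j) u v) L₂.Eq.refl g
  ... | no _  = bot≈⋁-const-bot 0ₒ (pos k)
  ⋁-distribʳ (pos i) -1ₒ c _ _ = bot≈⋁-const-bot (pos i) c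
  ⋁-distribʳ (pos i) 0ₒ c _ _ = bot≈⋁-const-bot (pos i) c
  ⋁-distribʳ (pos i) (pos j) -1ₒ _ _ = refl
  ⋁-distribʳ (pos i) (pos j) 0ₒ _ _ = refl
  ⋁-distribʳ (pos i) (pos j) (pos k) g u with i ≟F j | j ≟F k | i ≟F k
  ⋁-distribʳ (pos i) (pos j) (pos k) g true  | yes _ | yes _ | yes _ =
    map-twoJoin (𝟚 em) em (λ v → v) (≡-sym bot-𝟚) g
  ⋁-distribʳ (pos i) (pos j) (pos k) _ false | yes _ | yes _ | yes _ = false≡⋁-const-false
  ... | yes _ | no _  | yes _ = false≡⋁-const-false
  ... | no _  | _     | yes _ = false≡⋁-const-false
  ... | _     | _     | no _  = refl

  comp-absorbʳ : ∀ a b c (v : H b c) {u : H a b} → u ≈[ a ⇒ b ] ⊥[ a ⇒ b ] →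
                 comp a b c v u ≈[ a ⇒ c ] ⊥[ a ⇒ c ]
  comp-absorbʳ a b c v u≈bot = HomLattice.Eq.trans a c (comp-cong a b c (≈-refl b c) u≈bot)
    (HomLattice.Eq.trans a c (⋁-distribˡ a b c v (λ ()))
      (⋁-bot (Hom a c) _ (λ ())))

  comp-absorbˡ : ∀ a b c {v : H b c} (u : H a b) → v ≈[ b ⇒ c ] ⊥[ b ⇒ c ] →
                 comp a b c v u ≈[ a ⇒ c ] ⊥[ a ⇒ c ]
  comp-absorbˡ a b c u v≈bot = HomLattice.Eq.trans a c (comp-cong a b c v≈bot (≈-refl a b))
    (HomLattice.Eq.trans a c (⋁-distribʳ a b c (λ ()) u)
      (⋁-bot (Hom a c) _ (λ ())))

  comp-unitʳ : ∀ a b (v : H a b) {u : H a a} → u ≈[ a ⇒ a ] id a → comp a a b v u ≈[ a ⇒ b ] v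
  comp-unitʳ a b v u≈id =
    HomLattice.Eq.trans a b (comp-cong a a b (≈-refl a b) u≈id) (identityʳ a b v)

  comp-unitˡ : ∀ a b {v : H b b} (u : H a b) → v ≈[ b ⇒ b ] id b → comp a b b v u ≈[ a ⇒ b ] u
  comp-unitˡ a b u v≈id =
    HomLattice.Eq.trans a b (comp-cong a b b v≈id (≈-refl a b)) (identityˡ a b u)

  Associates : ∀ a b c d → H c d → H b c → H a b → Set
  Associates a b c d w v u = comp a c d w (comp a b c v u) ≈[ a ⇒ d ] comp a b d (comp b c d w v) u

  private
    ≈-via : ∀ a d {x y z : H a d} → x ≈[ a ⇒ d ] z → y ≈[ a ⇒ d ] z → x ≈[ a ⇒ d ] y
    ≈-via a d x≈z y≈z = HomLattice.Eq.trans a d x≈z (HomLattice.Eq.sym a d y≈z)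

  module _ a b c d (w : H c d) (v : H b c) (u : H a b) where
    assoc-botʳ : u ≈[ a ⇒ b ] ⊥[ a ⇒ b ] → Associates a b c d w v u
    assoc-botʳ u≈bot = ≈-via a d (comp-absorbʳ a c d w (comp-absorbʳ a b c v u≈bot))
                                  (comp-absorbʳ a b d (comp b c d w v) u≈bot)

    assoc-botᵐ : v ≈[ b ⇒ c ] ⊥[ b ⇒ c ] → Associates a b c d w v u
    assoc-botᵐ v≈bot = ≈-via a d (comp-absorbʳ a c d w (comp-absorbˡ a b c u v≈bot))
                                  (comp-absorbˡ a b d u (comp-absorbʳ b c d w v≈bot))

    assoc-botˡ : w ≈[ c ⇒ d ] ⊥[ c ⇒ d ] → Associates a b c d w v u
    assoc-botˡ w≈bot = ≈-via a d (comp-absorbˡ a c d (comp a b c v u) w≈bot)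
                                  (comp-absorbˡ a b d u (comp-absorbˡ b c d v w≈bot))

  IdOrBot : ∀ a → H a a → Set
  IdOrBot a u = u ≈[ a ⇒ a ] id a ⊎ u ≈[ a ⇒ a ] ⊥[ a ⇒ a ]

  assoc-endoʳ : ∀ a c d (w : H c d) (v : H a c) (u : H a a) → IdOrBot a u → Associates a a c d w v u
  assoc-endoʳ a c d w v u (inj₁ u≈id) =
    ≈-via a d (comp-cong a c d (≈-refl c d) (comp-unitʳ a c v u≈id))
              (comp-unitʳ a d (comp a c d w v) u≈id)
  assoc-endoʳ a c d w v u (inj₂ u≈bot) = assoc-botʳ a a c d w v u u≈bot

  assoc-endoᵐ : ∀ a b d (w : H b d) (v : H b b) (u : H a b) → IdOrBot b v → Associates a b b d w v u
  assoc-endoᵐ a b d w v u (inj₁ v≈id) =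
    ≈-via a d (comp-cong a b d (≈-refl b d) (comp-unitˡ a b u v≈id))
              (comp-cong a b d (comp-unitʳ b d w v≈id) (≈-refl a b))
  assoc-endoᵐ a b d w v u (inj₂ v≈bot) = assoc-botᵐ a b b d w v u v≈bot

  assoc-endoˡ : ∀ a b c (w : H c c) (v : H b c) (u : H a b) → IdOrBot c w → Associates a b c c w v u
  assoc-endoˡ a b c w v u (inj₁ w≈id) =
    ≈-via a c (comp-unitˡ a c (comp a b c v u) w≈id)
              (comp-cong a b c (comp-unitˡ b c v w≈id) (≈-refl a b))
  assoc-endoˡ a b c w v u (inj₂ w≈bot) = assoc-botˡ a b c c w v u w≈bot

  idOrBot : ∀ a (u : H a a) → IdOrBot a u
  idOrBot -1ₒ true  = inj₁ refl
  idOrBot -1ₒ false = inj₂ (≡-sym bot-𝟚)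
  idOrBot 0ₒ true  = inj₁ refl
  idOrBot 0ₒ false = inj₂ (≡-sym bot-𝟚)
  idOrBot (pos i) u with i ≟F i
  idOrBot (pos i) true  | yes _ = inj₁ refl
  idOrBot (pos i) false | yes _ = inj₂ (≡-sym bot-𝟚)
  ... | no i≢i = ⊥-elim (i≢i refl)

  data HomShape : Obj n → Obj n → Set where
    endo    : ∀ a → HomShape a a
    trivial : ∀ {a b} → (∀ (u : H a b) → u ≈[ a ⇒ b ] ⊥[ a ⇒ b ]) → HomShape a b
    hom-L₁  : HomShape -1ₒ 0ₒ
    hom-L₂  : ∀ i → HomShape 0ₒ (pos i)
    hom-P   : ∀ i → HomShape -1ₒ (pos i)

  homShape : ∀ a b → HomShape a b
  homShape -1ₒ -1ₒ = endo -1ₒ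
  homShape -1ₒ 0ₒ = hom-L₁
  homShape -1ₒ (pos i) = hom-P i
  homShape 0ₒ -1ₒ = trivial (λ _ → refl)
  homShape 0ₒ 0ₒ = endo 0ₒ
  homShape 0ₒ (pos i) = hom-L₂ i
  homShape (pos i) -1ₒ = trivial (λ _ → refl)
  homShape (pos i) 0ₒ = trivial (λ _ → refl)
  homShape (pos i) (pos j) with i ≟F j
  ... | yes refl = endo (pos i)
  ... | no i≢j  = trivial (diag-trivial (i ≟F j) i≢j)
    where
      diag-trivial : (d : Dec (i ≡ j)) → ¬ (i ≡ j) →
                     ∀ (u : ∣ diag d ∣) → CompleteLattice._≈_ (diag d) u (CompleteLattice.bot (diag d))
      diag-trivial (yes i≡j) i≢j _ = ⊥-elim (i≢j i≡j)
      diag-trivial (no _)    _   _ = refl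

  assoc : ∀ a b c d (w : H c d) (v : H b c) (u : H a b) → Associates a b c d w v u
  assoc a b c d w v u with homShape a b | homShape b c | homShape c d
  ... | trivial u≈bot | _ | _ = assoc-botʳ a b c d w v u (u≈bot u)
  ... | _ | trivial v≈bot | _ = assoc-botᵐ a b c d w v u (v≈bot v)
  ... | _ | _ | trivial w≈bot = assoc-botˡ a b c d w v u (w≈bot w)
  ... | endo _ | _ | _ = assoc-endoʳ a c d w v u (idOrBot a u)
  ... | _ | endo _ | _ = assoc-endoᵐ a b d w v u (idOrBot b v)
  ... | _ | _ | endo _ = assoc-endoˡ a b c w v u (idOrBot c w)

  isQuantaloid : IsQuantaloid (Obj n) Hom id comp
  isQuantaloid = record
    { comp-cong  = comp-cong
    ; assoc      = assoc
    ; identityˡ  = identityˡ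
    ; identityʳ  = identityʳ
    ; ⋁-distribˡ = ⋁-distribˡ
    ; ⋁-distribʳ = ⋁-distribʳ
    }

  implications : ∀ (i : Fin n) (u : ∣ L₁ ∣) (v : ∣ L₂ ∣) (w : ∣ P ∣) →
                 IsLeftImplication (Obj n) Hom id comp -1ₒ 0ₒ (pos i) w u (↖ i w u)
                 × IsRightImplication (Obj n) Hom id comp -1ₒ 0ₒ (pos i) w v (↙ i w v)
  implications i u v w = (λ v' → &ᵢ.&≤⇔≤↖ i u v' w) , (λ u' → &ᵢ.&≤⇔≤↙ i u' v w)

proposition3p3 : (em : ExcludedMiddle 0ℓ) {n : ℕ} (L : MultiAdjointFrame n) →
    let open MultiAdjointFrame L
        open QF em L
    in IsQuantaloid (Obj n) Hom id comp
       × NonTrivial (Obj n) Hom id comp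
       × (∀ (i : Fin n) (u : CompleteLattice.Carrier L₁) (v : CompleteLattice.Carrier L₂)
            (w : CompleteLattice.Carrier P) →
            IsLeftImplication (Obj n) Hom id comp -1ₒ 0ₒ (pos i) w u (↖ i w u)
            × IsRightImplication (Obj n) Hom id comp -1ₒ 0ₒ (pos i) w v (↙ i w v))
proposition3p3 em L = isQuantaloid , nonTrivial , implications
  where open QFProperties em L
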